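{- Let $E_n$ be defined by $\sum_{n\geqslant0}E_n\frac{z^n}{n!}=\tan z+\sec z$, and let $s_n$ be defined by $\sum_{n\geqslant0}s_n\frac{z^n}{n!}=\frac{1}{\cos z-\sin z}$. Then for every $n\geqslant1$, $$E_{2n-1}=\sum_{j=1}^{n}(-4)^{n-j}(2j-1)!\,U(n,j),\qquad E_{2n}=\sum_{j=0}^{n}(-1)^{n-j}(2j)!\,V(n,j),$$ $$s_{2n}=\sum_{j=0}^{n}(-1)^{n-j}(2j)!\,2^jV(n,j),\qquad s_{2n+1}=\sum_{j=0}^{n}(-1)^{n-j}(2j+1)!\,2^jV(n,j).$$
   Context: The numbers $U(n,k)$ ($n\geqslant1$) are defined by $U(1,1)=1$, $U(1,k)=0$ for $k\neq1$, $U(n,k)=U(n-1,k-1)+k^2U(n-1,k)$. The numbers $V(n,k)$ ($n,k\geqslant0$) are defined by $V(0,0)=1$, $V(0,k)=0$ for $k\neq0$, $V(n,k)=V(n-1,k-1)+(2k+1)^2V(n-1,k)$. -}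

module Defs where

open import Data.Nat as ℕ using (ℕ; zero; suc; _∸_; _!)
open import Data.Nat.Combinatorics using (_C_)
open import Data.Integer as ℤ using (ℤ; +_; -_)
open import Data.List using (List; map; upTo; foldr)

-- ∑ lo hi f  =  Σ_{i = lo}^{hi} f i   (empty, i.e. 0, when hi < lo)
∑ : ℕ → ℕ → (ℕ → ℤ) → ℤ
∑ lo hi f = foldr ℤ._+_ (+ 0) (map (λ i → f (lo ℕ.+ i)) (upTo (suc hi ∸ lo)))

-- U(n,k), defined for n ≥ 1 as in the paper (U 0 k is an unused dummy value 0);
-- U(n-1,k-1) for k = 0 is read as 0.
U : ℕ → ℕ → ℕ
U zero k = 0
U (suc zero) zero = 0
U (suc zero) (suc zero) = 1
U (suc zero) (suc (suc k)) = 0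
U (suc (suc n)) zero = 0 ℕ.* U (suc n) zero
U (suc (suc n)) (suc k) = U (suc n) k ℕ.+ (suc k ℕ.^ 2) ℕ.* U (suc n) (suc k)

-- V(n,k), n,k ≥ 0; V(n-1,k-1) for k = 0 is read as 0.
V : ℕ → ℕ → ℕ
V zero zero = 1
V zero (suc k) = 0
V (suc n) zero = (1 ℕ.^ 2) ℕ.* V n zero
V (suc n) (suc k) = V n k ℕ.+ ((2 ℕ.* suc k ℕ.+ 1) ℕ.^ 2) ℕ.* V n (suc k)

-- Formal power series are represented by their exponential coefficient
-- sequences a : ℕ → ℤ, i.e. Σ a n zⁿ/n!.  Product of EGFs:
egfMul : (ℕ → ℤ) → (ℕ → ℤ) → ℕ → ℤ
egfMul a b n = ∑ 0 n (λ k → (+ (n C k)) ℤ.* a k ℤ.* b (n ∸ k))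

oneC : ℕ → ℤ
oneC zero = + 1
oneC (suc n) = + 0

cosC : ℕ → ℤ
cosC zero = + 1
cosC (suc zero) = + 0
cosC (suc (suc n)) = - cosC n

sinC : ℕ → ℤ
sinC zero = + 0
sinC (suc zero) = + 1
sinC (suc (suc n)) = - sinC n

-- Let S m be the EGF of sin^m z / m!. Differentiating twice and using cos² = 1 − sin² gives
-- S_{m+2}(n+2) = S_m(n) − (m+2)² S_{m+2}(n), which up to the factors (−1)^(n−j) and (−4)^(n−j)
-- is the recurrence of V on odd and of U on even indices; S m also vanishes below degree m and
-- in the degrees of the wrong parity. Now tan + sec = (1 + sin) cos Σ_j sin^{2j} and
-- 1 / (cos − sin) = (cos + sin) Σ_j 2^j sin^{2j}. Cut after N terms, these geometric series
-- telescope, so the truncations agree with E and s below degree 2N (cancelling cos, resp.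
-- cos − sin, whose constant term is 1), and reading off their coefficients gives the formulas.
module Submission where

open import Defs
open import Data.Nat as ℕ using (ℕ; zero; suc; _∸_; _!; _≤_; _<_; z≤n; s≤s)
import Data.Nat.Properties as ℕP
open import Data.Nat.Combinatorics using (_C_; nCk+nC[k+1]≡[n+1]C[k+1]; k>n⇒nCk≡0; nCn≡1)
open import Data.Integer as ℤ using (ℤ; +_; -_; _+_; _*_; _-_; _^_; -1ℤ)
import Data.Integer.Properties as ℤP
open import Algebra.Properties.AbelianGroup ℤP.+-0-abelianGroup using (∙-cancelˡ)
open import Algebra.Properties.CommutativeSemigroup ℤP.+-commutativeSemigroup using (interchange)
open import Data.Integer.Tactic.RingSolver using (solve-∀)
open import Data.List using (map; foldr; applyUpTo)
open import Data.Sum using (inj₁; inj₂)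
open import Data.Product using (_×_; _,_)
open import Function using (id)
open import Relation.Binary.PropositionalEquality
open ≡-Reasoning

Σ< : ℕ → (ℕ → ℤ) → ℤ
Σ< zero    f = + 0
Σ< (suc n) f = f 0 + Σ< n (λ i → f (suc i))

∑≡Σ< : ∀ lo hi f → ∑ lo hi f ≡ Σ< (suc hi ∸ lo) (λ i → f (lo ℕ.+ i))
∑≡Σ< lo hi f = foldr-applyUpTo (λ i → f (lo ℕ.+ i)) id (suc hi ∸ lo)
  where
  foldr-applyUpTo : ∀ (g : ℕ → ℤ) (h : ℕ → ℕ) n →
                    foldr _+_ (+ 0) (map g (applyUpTo h n)) ≡ Σ< n (λ i → g (h i))
  foldr-applyUpTo g h zero    = refl
  foldr-applyUpTo g h (suc n) = cong (_+_ (g (h 0))) (foldr-applyUpTo g (λ i → h (suc i)) n)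

Σ<-cong : ∀ n {f g : ℕ → ℤ} → (∀ i → i < n → f i ≡ g i) → Σ< n f ≡ Σ< n g
Σ<-cong zero    f≡g = refl
Σ<-cong (suc n) f≡g = cong₂ _+_ (f≡g 0 (s≤s z≤n)) (Σ<-cong n (λ i i<n → f≡g (suc i) (s≤s i<n)))

Σ<-+ : ∀ n (f g : ℕ → ℤ) → Σ< n (λ i → f i + g i) ≡ Σ< n f + Σ< n g
Σ<-+ zero    f g = refl
Σ<-+ (suc n) f g = begin
  f 0 + g 0 + Σ< n (λ i → f (suc i) + g (suc i))
    ≡⟨ cong (_+_ (f 0 + g 0)) (Σ<-+ n (λ i → f (suc i)) (λ i → g (suc i))) ⟩
  f 0 + g 0 + (Σ< n (λ i → f (suc i)) + Σ< n (λ i → g (suc i)))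
    ≡⟨ interchange (f 0) (g 0) _ _ ⟩
  f 0 + Σ< n (λ i → f (suc i)) + (g 0 + Σ< n (λ i → g (suc i))) ∎

Σ<-last : ∀ n (f : ℕ → ℤ) → Σ< (suc n) f ≡ Σ< n f + f n
Σ<-last zero    f = trans (ℤP.+-identityʳ (f 0)) (sym (ℤP.+-identityˡ (f 0)))
Σ<-last (suc n) f = trans (cong (_+_ (f 0)) (Σ<-last n (λ i → f (suc i))))
                          (sym (ℤP.+-assoc (f 0) _ _))

Series : Set
Series = ℕ → ℤ

infixl 6 _⊕_ _⊖_
infixl 7 _⊙_ _⋆_

_⊕_ _⊖_ : Series → Series → Series
(a ⊕ b) n = a n + b n
(a ⊖ b) n = a n - b n

_⊙_ : ℤ → Series → Series
(k ⊙ a) n = k * a n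

0ₛ : Series
0ₛ n = + 0

Σₛ : ℕ → (ℕ → Series) → Series
Σₛ N g n = Σ< N (λ j → g j n)

-- On exponential generating functions differentiation is the shift.
∂ : Series → Series
∂ a n = a (suc n)

-- The Leibniz rule as definition makes associativity an easy induction; egfMul≗⋆ shows
-- that this is egfMul.
_⋆_ : Series → Series → Series
(a ⋆ b) zero    = a 0 * b 0
(a ⋆ b) (suc n) = (∂ a ⋆ b) n + (a ⋆ ∂ b) n

⋆-cong : ∀ {a a′ b b′} → a ≗ a′ → b ≗ b′ → a ⋆ b ≗ a′ ⋆ b′
⋆-cong a≗a′ b≗b′ zero    = cong₂ _*_ (a≗a′ 0) (b≗b′ 0)
⋆-cong a≗a′ b≗b′ (suc n) =
  cong₂ _+_ (⋆-cong (λ k → a≗a′ (suc k)) b≗b′ n) (⋆-cong a≗a′ (λ k → b≗b′ (suc k)) n)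

⋆-congˡ : ∀ {a a′} b → a ≗ a′ → a ⋆ b ≗ a′ ⋆ b
⋆-congˡ b a≗a′ = ⋆-cong a≗a′ (λ _ → refl)

⋆-congʳ : ∀ a {b b′} → b ≗ b′ → a ⋆ b ≗ a ⋆ b′
⋆-congʳ a = ⋆-cong (λ _ → refl)

⋆-comm : ∀ a b → a ⋆ b ≗ b ⋆ a
⋆-comm a b zero    = ℤP.*-comm (a 0) (b 0)
⋆-comm a b (suc n) = trans (cong₂ _+_ (⋆-comm (∂ a) b n) (⋆-comm a (∂ b) n))
                           (ℤP.+-comm ((b ⋆ ∂ a) n) ((∂ b ⋆ a) n))

⋆-distribʳ-⊕ : ∀ a b c → (a ⊕ b) ⋆ c ≗ a ⋆ c ⊕ b ⋆ c
⋆-distribʳ-⊕ a b c zero    = ℤP.*-distribʳ-+ (c 0) (a 0) (b 0)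
⋆-distribʳ-⊕ a b c (suc n) =
  trans (cong₂ _+_ (⋆-distribʳ-⊕ (∂ a) (∂ b) c n) (⋆-distribʳ-⊕ a b (∂ c) n))
        (interchange ((∂ a ⋆ c) n) ((∂ b ⋆ c) n) ((a ⋆ ∂ c) n) ((b ⋆ ∂ c) n))

⋆-distribʳ-⊖ : ∀ a b c → (a ⊖ b) ⋆ c ≗ a ⋆ c ⊖ b ⋆ c
⋆-distribʳ-⊖ a b c zero    = distribʳ (a 0) (b 0) (c 0)
  where
  distribʳ : ∀ x y z → (x - y) * z ≡ x * z - y * z
  distribʳ = solve-∀
⋆-distribʳ-⊖ a b c (suc n) =
  trans (cong₂ _+_ (⋆-distribʳ-⊖ (∂ a) (∂ b) c n) (⋆-distribʳ-⊖ a b (∂ c) n))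
        (interchange-⊖ ((∂ a ⋆ c) n) ((∂ b ⋆ c) n) ((a ⋆ ∂ c) n) ((b ⋆ ∂ c) n))
  where
  interchange-⊖ : ∀ w x y z → w - x + (y - z) ≡ w + y - (x + z)
  interchange-⊖ = solve-∀

⋆-distribˡ-⊕ : ∀ a b c → a ⋆ (b ⊕ c) ≗ a ⋆ b ⊕ a ⋆ c
⋆-distribˡ-⊕ a b c n = begin
  (a ⋆ (b ⊕ c)) n         ≡⟨ ⋆-comm a (b ⊕ c) n ⟩
  ((b ⊕ c) ⋆ a) n         ≡⟨ ⋆-distribʳ-⊕ b c a n ⟩
  (b ⋆ a) n + (c ⋆ a) n   ≡⟨ cong₂ _+_ (⋆-comm b a n) (⋆-comm c a n) ⟩
  (a ⋆ b) n + (a ⋆ c) n   ∎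

⋆-distribˡ-⊖ : ∀ a b c → a ⋆ (b ⊖ c) ≗ a ⋆ b ⊖ a ⋆ c
⋆-distribˡ-⊖ a b c n = begin
  (a ⋆ (b ⊖ c)) n         ≡⟨ ⋆-comm a (b ⊖ c) n ⟩
  ((b ⊖ c) ⋆ a) n         ≡⟨ ⋆-distribʳ-⊖ b c a n ⟩
  (b ⋆ a) n - (c ⋆ a) n   ≡⟨ cong₂ _-_ (⋆-comm b a n) (⋆-comm c a n) ⟩
  (a ⋆ b) n - (a ⋆ c) n   ∎

⋆-assoc : ∀ a b c → (a ⋆ b) ⋆ c ≗ a ⋆ (b ⋆ c)
⋆-assoc a b c zero    = ℤP.*-assoc (a 0) (b 0) (c 0)
⋆-assoc a b c (suc n) = begin
  ((∂ a ⋆ b ⊕ a ⋆ ∂ b) ⋆ c) n + ((a ⋆ b) ⋆ ∂ c) n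
    ≡⟨ cong (_+ ((a ⋆ b) ⋆ ∂ c) n) (⋆-distribʳ-⊕ (∂ a ⋆ b) (a ⋆ ∂ b) c n) ⟩
  ((∂ a ⋆ b) ⋆ c) n + ((a ⋆ ∂ b) ⋆ c) n + ((a ⋆ b) ⋆ ∂ c) n
    ≡⟨ cong₂ _+_ (cong₂ _+_ (⋆-assoc (∂ a) b c n) (⋆-assoc a (∂ b) c n)) (⋆-assoc a b (∂ c) n) ⟩
  (∂ a ⋆ (b ⋆ c)) n + (a ⋆ (∂ b ⋆ c)) n + (a ⋆ (b ⋆ ∂ c)) n
    ≡⟨ ℤP.+-assoc ((∂ a ⋆ (b ⋆ c)) n) _ _ ⟩
  (∂ a ⋆ (b ⋆ c)) n + ((a ⋆ (∂ b ⋆ c)) n + (a ⋆ (b ⋆ ∂ c)) n)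
    ≡⟨ cong (_+_ ((∂ a ⋆ (b ⋆ c)) n)) (sym (⋆-distribˡ-⊕ a (∂ b ⋆ c) (b ⋆ ∂ c) n)) ⟩
  (∂ a ⋆ (b ⋆ c)) n + (a ⋆ (∂ b ⋆ c ⊕ b ⋆ ∂ c)) n ∎

⋆-swap : ∀ a b c → a ⋆ (b ⋆ c) ≗ b ⋆ (a ⋆ c)
⋆-swap a b c n = begin
  (a ⋆ (b ⋆ c)) n ≡⟨ ⋆-assoc a b c n ⟨
  ((a ⋆ b) ⋆ c) n ≡⟨ ⋆-congˡ c (⋆-comm a b) n ⟩
  ((b ⋆ a) ⋆ c) n ≡⟨ ⋆-assoc b a c n ⟩
  (b ⋆ (a ⋆ c)) n ∎

⋆-rotate : ∀ a b c → (a ⋆ b) ⋆ c ≗ (a ⋆ c) ⋆ b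
⋆-rotate a b c n = begin
  ((a ⋆ b) ⋆ c) n ≡⟨ ⋆-assoc a b c n ⟩
  (a ⋆ (b ⋆ c)) n ≡⟨ ⋆-congʳ a (⋆-comm b c) n ⟩
  (a ⋆ (c ⋆ b)) n ≡⟨ ⋆-assoc a c b n ⟨
  ((a ⋆ c) ⋆ b) n ∎

⋆-scaleˡ : ∀ k a b → (k ⊙ a) ⋆ b ≗ k ⊙ (a ⋆ b)
⋆-scaleˡ k a b zero    = ℤP.*-assoc k (a 0) (b 0)
⋆-scaleˡ k a b (suc n) = trans (cong₂ _+_ (⋆-scaleˡ k (∂ a) b n) (⋆-scaleˡ k a (∂ b) n))
                               (sym (ℤP.*-distribˡ-+ k _ _))

⋆-scaleʳ : ∀ k a b → a ⋆ (k ⊙ b) ≗ k ⊙ (a ⋆ b)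
⋆-scaleʳ k a b n = begin
  (a ⋆ (k ⊙ b)) n ≡⟨ ⋆-comm a (k ⊙ b) n ⟩
  ((k ⊙ b) ⋆ a) n ≡⟨ ⋆-scaleˡ k b a n ⟩
  k * (b ⋆ a) n   ≡⟨ cong (k *_) (⋆-comm b a n) ⟩
  k * (a ⋆ b) n   ∎

⋆-zeroˡ : ∀ b → 0ₛ ⋆ b ≗ 0ₛ
⋆-zeroˡ b zero    = refl
⋆-zeroˡ b (suc n) = cong₂ _+_ (⋆-zeroˡ b n) (⋆-zeroˡ (∂ b) n)

⋆-zeroʳ : ∀ a → a ⋆ 0ₛ ≗ 0ₛ
⋆-zeroʳ a n = trans (⋆-comm a 0ₛ n) (⋆-zeroˡ a n)

⋆-identityˡ : ∀ b → oneC ⋆ b ≗ b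
⋆-identityˡ b zero    = ℤP.*-identityˡ (b 0)
⋆-identityˡ b (suc n) = trans (cong₂ _+_ (⋆-zeroˡ b n) (⋆-identityˡ (∂ b) n)) (ℤP.+-identityˡ _)

⋆-identityʳ : ∀ a → a ⋆ oneC ≗ a
⋆-identityʳ a n = trans (⋆-comm a oneC n) (⋆-identityˡ a n)

⋆-Σₛ : ∀ a N (g : ℕ → Series) → a ⋆ Σₛ N g ≗ Σₛ N (λ j → a ⋆ g j)
⋆-Σₛ a zero    g n = ⋆-zeroʳ a n
⋆-Σₛ a (suc N) g n = trans (⋆-distribˡ-⊕ a (g 0) (Σₛ N (λ j → g (suc j))) n)
                           (cong (_+_ ((a ⋆ g 0) n)) (⋆-Σₛ a N (λ j → g (suc j)) n))

⋆-Σₛ-⊙ : ∀ a N (c : ℕ → ℤ) (h : ℕ → Series) →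
         a ⋆ Σₛ N (λ j → c j ⊙ h j) ≗ Σₛ N (λ j → c j ⊙ (a ⋆ h j))
⋆-Σₛ-⊙ a N c h n =
  trans (⋆-Σₛ a N (λ j → c j ⊙ h j) n) (Σ<-cong N (λ j _ → ⋆-scaleʳ (c j) a (h j) n))

∸-suc : ∀ {n k} → k < n → n ∸ k ≡ suc (n ∸ suc k)
∸-suc {suc n} {zero}  _         = refl
∸-suc {suc n} {suc k} (s≤s k<n) = ∸-suc k<n

binomialSum : ℕ → Series → Series → ℤ
binomialSum n a b = Σ< (suc n) (λ k → + (n C k) * a k * b (n ∸ k))

binomialSum-suc : ∀ n a b → binomialSum (suc n) a b ≡ binomialSum n (∂ a) b + binomialSum n a (∂ b)
binomialSum-suc n a b = begin
  first + Σ< (suc n) (λ k → + (suc n C suc k) * a (suc k) * b (n ∸ k))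
    ≡⟨ cong (_+_ first) (trans (Σ<-cong (suc n) (λ k _ → pascal k))
                               (Σ<-+ (suc n) (λ k → + (n C k) * a (suc k) * b (n ∸ k)) shifted)) ⟩
  first + (binomialSum n (∂ a) b + Σ< (suc n) shifted)
    ≡⟨ cong (λ t → first + (binomialSum n (∂ a) b + t)) shifted-last ⟩
  first + (binomialSum n (∂ a) b + Σ< n (λ k → + (n C suc k) * a (suc k) * ∂ b (n ∸ suc k)))
    ≡⟨ +-left-comm first (binomialSum n (∂ a) b) _ ⟩
  binomialSum n (∂ a) b + binomialSum n a (∂ b) ∎
  where
  first = + 1 * a 0 * b (suc n)
  shifted : ℕ → ℤ
  shifted k = + (n C suc k) * a (suc k) * b (n ∸ k)
  +-left-comm : ∀ x y z → x + (y + z) ≡ y + (x + z)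
  +-left-comm = solve-∀
  distribʳ² : ∀ x y z w → (x + y) * z * w ≡ x * z * w + y * z * w
  distribʳ² = solve-∀
  pascal : ∀ k → + (suc n C suc k) * a (suc k) * b (n ∸ k)
               ≡ + (n C k) * a (suc k) * b (n ∸ k) + shifted k
  pascal k = begin
    + (suc n C suc k) * a (suc k) * b (n ∸ k)
      ≡⟨ cong (λ c → + c * a (suc k) * b (n ∸ k)) (nCk+nC[k+1]≡[n+1]C[k+1] n k) ⟨
    + (n C k ℕ.+ n C suc k) * a (suc k) * b (n ∸ k)
      ≡⟨ cong (λ c → c * a (suc k) * b (n ∸ k)) (ℤP.pos-+ (n C k) (n C suc k)) ⟩
    (+ (n C k) + + (n C suc k)) * a (suc k) * b (n ∸ k)
      ≡⟨ distribʳ² (+ (n C k)) (+ (n C suc k)) (a (suc k)) (b (n ∸ k)) ⟩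
    + (n C k) * a (suc k) * b (n ∸ k) + shifted k ∎
  shifted-last : Σ< (suc n) shifted ≡ Σ< n (λ k → + (n C suc k) * a (suc k) * ∂ b (n ∸ suc k))
  shifted-last = begin
    Σ< (suc n) shifted                 ≡⟨ Σ<-last n shifted ⟩
    Σ< n shifted + shifted n
      ≡⟨ cong₂ _+_ (Σ<-cong n (λ k k<n → cong (λ m → + (n C suc k) * a (suc k) * b m) (∸-suc k<n)))
                   (cong (λ c → + c * a (suc n) * b (n ∸ n)) (k>n⇒nCk≡0 (ℕP.n<1+n n))) ⟩
    Σ< n (λ k → + (n C suc k) * a (suc k) * ∂ b (n ∸ suc k)) + + 0
                                       ≡⟨ ℤP.+-identityʳ _ ⟩
    Σ< n (λ k → + (n C suc k) * a (suc k) * ∂ b (n ∸ suc k)) ∎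

binomialSum≡⋆ : ∀ n a b → binomialSum n a b ≡ (a ⋆ b) n
binomialSum≡⋆ zero    a b = trans (ℤP.+-identityʳ _) (cong (_* b 0) (ℤP.*-identityˡ (a 0)))
binomialSum≡⋆ (suc n) a b =
  trans (binomialSum-suc n a b) (cong₂ _+_ (binomialSum≡⋆ n (∂ a) b) (binomialSum≡⋆ n a (∂ b)))

egfMul≗⋆ : ∀ a b → egfMul a b ≗ a ⋆ b
egfMul≗⋆ a b n = trans (∑≡Σ< 0 n (λ k → + (n C k) * a k * b (n ∸ k))) (binomialSum≡⋆ n a b)

infix 4 _≗[<_]_
_≗[<_]_ : Series → ℕ → Series → Set
a ≗[< m ] b = ∀ n → n < m → a n ≡ b n

binomialSum-last : ∀ n a c → c 0 ≡ + 1 →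
                   binomialSum n a c ≡ Σ< n (λ k → + (n C k) * a k * c (n ∸ k)) + a n
binomialSum-last n a c c0≡1 = begin
  binomialSum n a c                       ≡⟨ Σ<-last n f ⟩
  Σ< n f + + (n C n) * a n * c (n ∸ n)
    ≡⟨ cong₂ (λ x y → Σ< n f + + x * a n * c y) (nCn≡1 n) (ℕP.n∸n≡0 n) ⟩
  Σ< n f + + 1 * a n * c 0                ≡⟨ cong (λ y → Σ< n f + + 1 * a n * y) c0≡1 ⟩
  Σ< n f + + 1 * a n * + 1                ≡⟨ cong (_+_ (Σ< n f)) (unit (a n)) ⟩
  Σ< n f + a n                            ∎
  where
  f : ℕ → ℤ
  f k = + (n C k) * a k * c (n ∸ k)
  unit : ∀ x → + 1 * x * + 1 ≡ x
  unit = solve-∀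

≗[<]-pred : ∀ {a b m} → a ≗[< suc m ] b → a ≗[< m ] b
≗[<]-pred a≗b n n<m = a≗b n (ℕP.m<n⇒m<1+n n<m)

≗[<]-suc : ∀ {a b m} → a ≗[< m ] b → a m ≡ b m → a ≗[< suc m ] b
≗[<]-suc below top n n<1+m with ℕP.m<1+n⇒m<n∨m≡n n<1+m
... | inj₁ n<m  = below n n<m
... | inj₂ refl = top

-- Since c 0 = 1, the n-th coefficient of a ⋆ c is a n plus terms in the a k with k < n.
⋆-cancelʳ-at : ∀ {a b} c n → c 0 ≡ + 1 → a ≗[< n ] b → (a ⋆ c) n ≡ (b ⋆ c) n → a n ≡ b n
⋆-cancelʳ-at {a} {b} c n c0≡1 below ac≡bc = ∙-cancelˡ (Σ< n (lower b)) (a n) (b n) (begin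
  Σ< n (lower b) + a n  ≡⟨ cong (_+ a n) (Σ<-cong n (λ k k<n → cong (lower′ k) (below k k<n))) ⟨
  Σ< n (lower a) + a n  ≡⟨ binomialSum-last n a c c0≡1 ⟨
  binomialSum n a c     ≡⟨ binomialSum≡⋆ n a c ⟩
  (a ⋆ c) n             ≡⟨ ac≡bc ⟩
  (b ⋆ c) n             ≡⟨ binomialSum≡⋆ n b c ⟨
  binomialSum n b c     ≡⟨ binomialSum-last n b c c0≡1 ⟩
  Σ< n (lower b) + b n  ∎)
  where
  lower′ : ℕ → ℤ → ℤ
  lower′ k x = + (n C k) * x * c (n ∸ k)
  lower : Series → ℕ → ℤ
  lower d k = lower′ k (d k)

⋆-cancelʳ-below : ∀ {a b} c m → c 0 ≡ + 1 → a ⋆ c ≗[< m ] b ⋆ c → a ≗[< m ] b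
⋆-cancelʳ-below c zero    c0≡1 ac≡bc n ()
⋆-cancelʳ-below c (suc m) c0≡1 ac≡bc =
  ≗[<]-suc below (⋆-cancelʳ-at c m c0≡1 below (ac≡bc m (ℕP.n<1+n m)))
  where
  below = ⋆-cancelʳ-below c m c0≡1 (≗[<]-pred ac≡bc)

⋆-vanishes-below : ∀ a {b} m → b ≗[< m ] 0ₛ → a ⋆ b ≗[< m ] 0ₛ
⋆-vanishes-below a (suc m) b≗0 zero    _         =
  trans (cong (a 0 *_) (b≗0 0 (s≤s z≤n))) (ℤP.*-zeroʳ (a 0))
⋆-vanishes-below a (suc m) b≗0 (suc n) (s≤s n<m) = cong₂ _+_
  (⋆-vanishes-below (∂ a) m (≗[<]-pred b≗0) n n<m)
  (⋆-vanishes-below a m (λ k k<m → b≗0 (suc k) (s≤s k<m)) n n<m)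

⋆-telescope : ∀ r (g : ℕ → Series) → (∀ j → r ⋆ g j ≗ g (suc j)) →
              ∀ N → (oneC ⊖ r) ⋆ Σₛ N g ≗ g 0 ⊖ g N
⋆-telescope r g step zero    n = trans (⋆-zeroʳ (oneC ⊖ r) n) (sym (ℤP.+-inverseʳ (g 0 n)))
⋆-telescope r g step (suc N) n = begin
  ((oneC ⊖ r) ⋆ Σₛ (suc N) g) n
    ≡⟨ ⋆-congʳ (oneC ⊖ r) (λ k → Σ<-last N (λ j → g j k)) n ⟩
  ((oneC ⊖ r) ⋆ (Σₛ N g ⊕ g N)) n
    ≡⟨ ⋆-distribˡ-⊕ (oneC ⊖ r) (Σₛ N g) (g N) n ⟩
  ((oneC ⊖ r) ⋆ Σₛ N g) n + ((oneC ⊖ r) ⋆ g N) n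
    ≡⟨ cong₂ _+_ (⋆-telescope r g step N n) (⋆-distribʳ-⊖ oneC r (g N) n) ⟩
  g 0 n - g N n + ((oneC ⋆ g N) n - (r ⋆ g N) n)
    ≡⟨ cong₂ (λ x y → g 0 n - g N n + (x - y)) (⋆-identityˡ (g N) n) (step N n) ⟩
  g 0 n - g N n + (g N n - g (suc N) n)
    ≡⟨ cancel (g 0 n) (g N n) (g (suc N) n) ⟩
  g 0 n - g (suc N) n ∎
  where
  cancel : ∀ x y z → x - y + (y - z) ≡ x - z
  cancel = solve-∀

∂sin : ∂ sinC ≗ cosC
∂sin zero          = refl
∂sin (suc zero)    = refl
∂sin (suc (suc n)) = cong -_ (∂sin n)

∂cos : ∂ cosC ≗ - + 1 ⊙ sinC
∂cos zero          = refl
∂cos (suc zero)    = refl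
∂cos (suc (suc n)) = trans (cong -_ (∂cos n)) (neg-pull (sinC n))
  where
  neg-pull : ∀ x → - (- + 1 * x) ≡ - + 1 * - x
  neg-pull = solve-∀

cos²+sin² : cosC ⋆ cosC ⊕ sinC ⋆ sinC ≗ oneC
cos²+sin² zero    = refl
cos²+sin² (suc n) = begin
  (∂ cosC ⋆ cosC) n + (cosC ⋆ ∂ cosC) n + ((∂ sinC ⋆ sinC) n + (sinC ⋆ ∂ sinC) n)
    ≡⟨ cong₂ _+_
         (cong₂ _+_ (trans (⋆-congˡ cosC ∂cos n) (⋆-scaleˡ (- + 1) sinC cosC n))
                    (trans (⋆-congʳ cosC ∂cos n) (⋆-scaleʳ (- + 1) cosC sinC n)))
         (cong₂ _+_ (⋆-congˡ sinC ∂sin n) (⋆-congʳ sinC ∂sin n)) ⟩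
  - + 1 * (sinC ⋆ cosC) n + - + 1 * (cosC ⋆ sinC) n + ((cosC ⋆ sinC) n + (sinC ⋆ cosC) n)
    ≡⟨ cancel ((sinC ⋆ cosC) n) ((cosC ⋆ sinC) n) ⟩
  + 0 ∎
  where
  cancel : ∀ x y → - + 1 * x + - + 1 * y + (y + x) ≡ + 0
  cancel = solve-∀

cos² : cosC ⋆ cosC ≗ oneC ⊖ sinC ⋆ sinC
cos² n = begin
  (cosC ⋆ cosC) n                                      ≡⟨ add-sub ((cosC ⋆ cosC) n) ((sinC ⋆ sinC) n) ⟨
  (cosC ⋆ cosC) n + (sinC ⋆ sinC) n - (sinC ⋆ sinC) n  ≡⟨ cong (_- (sinC ⋆ sinC) n) (cos²+sin² n) ⟩
  oneC n - (sinC ⋆ sinC) n                             ∎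
  where
  add-sub : ∀ x y → x + y - y ≡ x
  add-sub = solve-∀

-- S m is the exponential generating function of sin^m z / m!.
S : ℕ → Series
S zero          = oneC
S (suc m) zero    = + 0
S (suc m) (suc n) = (cosC ⋆ S m) n

S-one : S 1 ≗ sinC
S-one zero    = refl
S-one (suc n) = trans (⋆-identityʳ cosC n) (sym (∂sin n))

sin⋆S : ∀ m → sinC ⋆ S m ≗ + suc m ⊙ S (suc m)
sin⋆S zero    zero    = refl
sin⋆S zero    (suc n) = begin
  (∂ sinC ⋆ oneC) n + (sinC ⋆ 0ₛ) n  ≡⟨ cong₂ _+_ (⋆-congˡ oneC ∂sin n) (⋆-zeroʳ sinC n) ⟩
  (cosC ⋆ oneC) n + + 0              ≡⟨ ℤP.+-identityʳ _ ⟩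
  (cosC ⋆ oneC) n                    ≡⟨ ℤP.*-identityˡ _ ⟨
  + 1 * (cosC ⋆ oneC) n              ∎
sin⋆S (suc m) zero    = sym (ℤP.*-zeroʳ (+ suc (suc m)))
sin⋆S (suc m) (suc n) = begin
  (∂ sinC ⋆ S (suc m)) n + (sinC ⋆ (cosC ⋆ S m)) n
    ≡⟨ cong₂ _+_ (⋆-congˡ (S (suc m)) ∂sin n) (⋆-swap sinC cosC (S m) n) ⟩
  (cosC ⋆ S (suc m)) n + (cosC ⋆ (sinC ⋆ S m)) n
    ≡⟨ cong (_+_ ((cosC ⋆ S (suc m)) n))
            (trans (⋆-congʳ cosC (sin⋆S m) n) (⋆-scaleʳ (+ suc m) cosC (S (suc m)) n)) ⟩
  (cosC ⋆ S (suc m)) n + + suc m * (cosC ⋆ S (suc m)) n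
    ≡⟨ one-plus ((cosC ⋆ S (suc m)) n) (+ suc m) ⟩
  (+ 1 + + suc m) * (cosC ⋆ S (suc m)) n ∎
  where
  one-plus : ∀ x k → x + k * x ≡ (+ 1 + k) * x
  one-plus = solve-∀

sin²⋆S : ∀ m → (sinC ⋆ sinC) ⋆ S m ≗ (+ suc m * + suc (suc m)) ⊙ S (suc (suc m))
sin²⋆S m n = begin
  ((sinC ⋆ sinC) ⋆ S m) n                       ≡⟨ ⋆-assoc sinC sinC (S m) n ⟩
  (sinC ⋆ (sinC ⋆ S m)) n                       ≡⟨ ⋆-congʳ sinC (sin⋆S m) n ⟩
  (sinC ⋆ (+ suc m ⊙ S (suc m))) n              ≡⟨ ⋆-scaleʳ (+ suc m) sinC (S (suc m)) n ⟩
  + suc m * (sinC ⋆ S (suc m)) n                ≡⟨ cong (+ suc m *_) (sin⋆S (suc m) n) ⟩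
  + suc m * (+ suc (suc m) * S (suc (suc m)) n) ≡⟨ ℤP.*-assoc (+ suc m) (+ suc (suc m)) (S (suc (suc m)) n) ⟨
  + suc m * + suc (suc m) * S (suc (suc m)) n   ∎

S-recurrence : ∀ m n → S (2 ℕ.+ m) (2 ℕ.+ n) ≡ S m n - + (2 ℕ.+ m) * + (2 ℕ.+ m) * S (2 ℕ.+ m) n
S-recurrence m n = begin
  (∂ cosC ⋆ S (suc m)) n + (cosC ⋆ (cosC ⋆ S m)) n
    ≡⟨ cong₂ _+_ (trans (⋆-congˡ (S (suc m)) ∂cos n) (⋆-scaleˡ (- + 1) sinC (S (suc m)) n))
                 (sym (⋆-assoc cosC cosC (S m) n)) ⟩
  - + 1 * (sinC ⋆ S (suc m)) n + ((cosC ⋆ cosC) ⋆ S m) n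
    ≡⟨ cong₂ _+_ (cong (- + 1 *_) (sin⋆S (suc m) n)) cos²⋆S ⟩
  - + 1 * (+ suc (suc m) * S (suc (suc m)) n) + (S m n - + suc m * + suc (suc m) * S (suc (suc m)) n)
    ≡⟨ collect (+ suc m) (S m n) (S (suc (suc m)) n) ⟩
  S m n - + (2 ℕ.+ m) * + (2 ℕ.+ m) * S (2 ℕ.+ m) n ∎
  where
  collect : ∀ k x y → - + 1 * ((+ 1 + k) * y) + (x - k * (+ 1 + k) * y)
                    ≡ x - (+ 1 + k) * (+ 1 + k) * y
  collect = solve-∀
  cos²⋆S : ((cosC ⋆ cosC) ⋆ S m) n ≡ S m n - + suc m * + suc (suc m) * S (suc (suc m)) n
  cos²⋆S = begin
    ((cosC ⋆ cosC) ⋆ S m) n                       ≡⟨ ⋆-congˡ (S m) cos² n ⟩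
    ((oneC ⊖ sinC ⋆ sinC) ⋆ S m) n                ≡⟨ ⋆-distribʳ-⊖ oneC (sinC ⋆ sinC) (S m) n ⟩
    (oneC ⋆ S m) n - ((sinC ⋆ sinC) ⋆ S m) n      ≡⟨ cong₂ _-_ (⋆-identityˡ (S m) n) (sin²⋆S m n) ⟩
    S m n - + suc m * + suc (suc m) * S (suc (suc m)) n ∎

S-step-zero : ∀ m n → S m n ≡ + 0 → S (2 ℕ.+ m) n ≡ + 0 → S (2 ℕ.+ m) (2 ℕ.+ n) ≡ + 0
S-step-zero m n Smn≡0 S2mn≡0 = begin
  S (2 ℕ.+ m) (2 ℕ.+ n)                              ≡⟨ S-recurrence m n ⟩
  S m n - c * c * S (2 ℕ.+ m) n                      ≡⟨ cong₂ (λ x y → x - c * c * y) Smn≡0 S2mn≡0 ⟩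
  + 0 - c * c * + 0                                  ≡⟨ vanish c ⟩
  + 0                                                ∎
  where
  c = + (2 ℕ.+ m)
  vanish : ∀ c → + 0 - c * c * + 0 ≡ + 0
  vanish = solve-∀

S-below : ∀ {m n} → n < m → S m n ≡ + 0
S-below {suc m}       {zero}        _                = refl
S-below {suc zero}    {suc zero}    (s≤s ())
S-below {suc (suc m)} {suc zero}    _                = refl
S-below {suc (suc m)} {suc (suc n)} (s≤s (s≤s n<m)) =
  S-step-zero m n (S-below n<m) (S-below (ℕP.m<n⇒m<1+n (ℕP.m<n⇒m<1+n n<m)))

double : ℕ → ℕ
double zero    = zero
double (suc n) = suc (suc (double n))

2*≡double : ∀ n → 2 ℕ.* n ≡ double n
2*≡double zero    = refl
2*≡double (suc n) = trans (cong suc (ℕP.+-suc n (n ℕ.+ 0))) (cong (λ m → suc (suc m)) (2*≡double n))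

2*+1≡suc-double : ∀ n → 2 ℕ.* n ℕ.+ 1 ≡ suc (double n)
2*+1≡suc-double n = trans (ℕP.+-comm (2 ℕ.* n) 1) (cong suc (2*≡double n))

sin-even : ∀ n → sinC (double n) ≡ + 0
sin-even zero    = refl
sin-even (suc n) = cong -_ (sin-even n)

S-odd-even : ∀ j n → S (suc (double j)) (double n) ≡ + 0
S-odd-even j       zero    = refl
S-odd-even zero    (suc n) = trans (S-one (double (suc n))) (sin-even (suc n))
S-odd-even (suc j) (suc n) = S-step-zero (suc (double j)) (double n) (S-odd-even j n) (S-odd-even (suc j) n)

S-even-odd : ∀ j n → S (double j) (suc (double n)) ≡ + 0
S-even-odd zero    n       = refl
S-even-odd (suc j) zero    = refl
S-even-odd (suc j) (suc n) = S-step-zero (double j) (suc (double n)) (S-even-odd j n) (S-even-odd (suc j) n)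

-- If T(n+1,k+1) = T(n,k) + w T(n,k+1) then q^(n−k) T(n,k) obeys the same recurrence with
-- weight q w; where n ∸ k truncates (k ≥ n) this needs T(n,k+1) = 0.
twist-step : ∀ q w n k x y → (n ≤ k → y ≡ + 0) →
             q ^ (n ∸ k) * x + q * w * (q ^ (n ∸ suc k) * y) ≡ q ^ (n ∸ k) * (x + w * y)
twist-step q w n k x y y≡0 with ℕP.<-≤-connex k n
... | inj₁ k<n rewrite ∸-suc k<n = factor q w (q ^ (n ∸ suc k)) x y
  where
  factor : ∀ q w p x y → q * p * x + q * w * (p * y) ≡ q * p * (x + w * y)
  factor = solve-∀
... | inj₂ n≤k rewrite y≡0 n≤k = drop (q ^ (n ∸ k)) q w (q ^ (n ∸ suc k)) x
  where
  drop : ∀ p q w p′ x → p * x + q * w * (p′ * + 0) ≡ p * (x + w * + 0)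
  drop = solve-∀

pos-square : ∀ x → + (x ℕ.^ 2) ≡ + x * + x
pos-square x = trans (cong (λ y → + (x ℕ.* y)) (ℕP.*-identityʳ x)) (ℤP.pos-* x x)

V-above : ∀ {n j} → n < j → V n j ≡ 0
V-above {zero}  {suc j} _         = refl
V-above {suc n} {suc j} (s≤s n<j) =
  trans (cong₂ (λ x y → x ℕ.+ ((2 ℕ.* suc j ℕ.+ 1) ℕ.^ 2) ℕ.* y)
               (V-above n<j) (V-above (ℕP.m<n⇒m<1+n n<j)))
        (ℕP.*-zeroʳ ((2 ℕ.* suc j ℕ.+ 1) ℕ.^ 2))

U-above : ∀ {n j} → n < j → U n j ≡ 0
U-above {zero}        {j}           _         = refl
U-above {suc zero}    {suc zero}    (s≤s ())
U-above {suc zero}    {suc (suc j)} _         = refl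
U-above {suc (suc n)} {suc j}       (s≤s n<j) =
  trans (cong₂ (λ x y → x ℕ.+ (suc j ℕ.^ 2) ℕ.* y) (U-above n<j) (U-above (ℕP.m<n⇒m<1+n n<j)))
        (ℕP.*-zeroʳ (suc j ℕ.^ 2))

V-suc-suc : ∀ n k → let c = + suc (double (suc k)) in
            + V (suc n) (suc k) ≡ + V n k + c * c * + V n (suc k)
V-suc-suc n k = begin
  + (V n k ℕ.+ (2 ℕ.* suc k ℕ.+ 1) ℕ.^ 2 ℕ.* V n (suc k))
    ≡⟨ ℤP.pos-+ (V n k) ((2 ℕ.* suc k ℕ.+ 1) ℕ.^ 2 ℕ.* V n (suc k)) ⟩
  + V n k + + ((2 ℕ.* suc k ℕ.+ 1) ℕ.^ 2 ℕ.* V n (suc k))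
    ≡⟨ cong (_+_ (+ V n k)) (ℤP.pos-* ((2 ℕ.* suc k ℕ.+ 1) ℕ.^ 2) (V n (suc k))) ⟩
  + V n k + + ((2 ℕ.* suc k ℕ.+ 1) ℕ.^ 2) * + V n (suc k)
    ≡⟨ cong (λ x → + V n k + x * + V n (suc k))
            (trans (pos-square (2 ℕ.* suc k ℕ.+ 1)) (cong (λ m → + m * + m) (2*+1≡suc-double (suc k)))) ⟩
  + V n k + + suc (double (suc k)) * + suc (double (suc k)) * + V n (suc k) ∎

U-suc-suc : ∀ n k → + U (suc (suc n)) (suc k) ≡ + U (suc n) k + + suc k * + suc k * + U (suc n) (suc k)
U-suc-suc n k = begin
  + (U (suc n) k ℕ.+ suc k ℕ.^ 2 ℕ.* U (suc n) (suc k))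
    ≡⟨ ℤP.pos-+ (U (suc n) k) (suc k ℕ.^ 2 ℕ.* U (suc n) (suc k)) ⟩
  + U (suc n) k + + (suc k ℕ.^ 2 ℕ.* U (suc n) (suc k))
    ≡⟨ cong (_+_ (+ U (suc n) k)) (ℤP.pos-* (suc k ℕ.^ 2) (U (suc n) (suc k))) ⟩
  + U (suc n) k + + (suc k ℕ.^ 2) * + U (suc n) (suc k)
    ≡⟨ cong (λ x → + U (suc n) k + x * + U (suc n) (suc k)) (pos-square (suc k)) ⟩
  + U (suc n) k + + suc k * + suc k * + U (suc n) (suc k) ∎

S-odd-odd : ∀ n j → S (suc (double j)) (suc (double n)) ≡ -1ℤ ^ (n ∸ j) * + V n j
S-odd-odd zero    zero    = refl
S-odd-odd zero    (suc j) = refl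
S-odd-odd (suc n) zero    = begin
  S 1 (suc (double (suc n)))         ≡⟨ S-one (suc (double (suc n))) ⟩
  - sinC (suc (double n))            ≡⟨ cong -_ (S-one (suc (double n))) ⟨
  - S 1 (suc (double n))             ≡⟨ cong -_ (S-odd-odd n zero) ⟩
  - (-1ℤ ^ n * + V n 0)              ≡⟨ neg-as-mul (-1ℤ ^ n) (+ V n 0) ⟩
  -1ℤ * -1ℤ ^ n * + V n 0            ≡⟨ cong (λ v → -1ℤ * -1ℤ ^ n * + v) (ℕP.*-identityˡ (V n 0)) ⟨
  -1ℤ ^ suc n * + V (suc n) 0        ∎
  where
  neg-as-mul : ∀ x y → - (x * y) ≡ - + 1 * x * y
  neg-as-mul = solve-∀
S-odd-odd (suc n) (suc j) = begin
  S (2 ℕ.+ suc (double j)) (2 ℕ.+ suc (double n))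
    ≡⟨ S-recurrence (suc (double j)) (suc (double n)) ⟩
  S (suc (double j)) (suc (double n)) - c * c * S (suc (double (suc j))) (suc (double n))
    ≡⟨ cong₂ (λ x y → x - c * c * y) (S-odd-odd n j) (S-odd-odd n (suc j)) ⟩
  t₀ - c * c * t₁                     ≡⟨ sub-as-neg t₀ (c * c) t₁ ⟩
  t₀ + -1ℤ * (c * c) * t₁
    ≡⟨ twist-step -1ℤ (c * c) n j (+ V n j) (+ V n (suc j)) (λ n≤j → cong +_ (V-above (s≤s n≤j))) ⟩
  -1ℤ ^ (n ∸ j) * (+ V n j + c * c * + V n (suc j))
    ≡⟨ cong (-1ℤ ^ (n ∸ j) *_) (V-suc-suc n j) ⟨
  -1ℤ ^ (n ∸ j) * + V (suc n) (suc j) ∎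
  where
  c = + (2 ℕ.+ suc (double j))
  t₀ = -1ℤ ^ (n ∸ j) * + V n j
  t₁ = -1ℤ ^ (n ∸ suc j) * + V n (suc j)
  sub-as-neg : ∀ x w y → x - w * y ≡ x + - + 1 * w * y
  sub-as-neg = solve-∀

S-even-even : ∀ n j → S (double j) (double (suc n)) ≡ (- + 4) ^ (suc n ∸ j) * + U (suc n) j
S-even-even zero    zero          = refl
S-even-even zero    (suc zero)    = refl
S-even-even zero    (suc (suc j)) = S-below {double (suc (suc j))} {2} (s≤s (s≤s (s≤s z≤n)))
S-even-even (suc n) zero          = sym (ℤP.*-zeroʳ ((- + 4) ^ suc (suc n)))
S-even-even (suc n) (suc j)       = begin
  S (2 ℕ.+ double j) (2 ℕ.+ double (suc n))
    ≡⟨ S-recurrence (double j) (double (suc n)) ⟩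
  S (double j) (double (suc n)) - c * c * S (double (suc j)) (double (suc n))
    ≡⟨ cong₂ (λ x y → x - c * c * y) (S-even-even n j) (S-even-even n (suc j)) ⟩
  t₀ - c * c * t₁                     ≡⟨ cong (λ c → t₀ - c * c * t₁) c≡2*suc-j ⟩
  t₀ - + 2 * s * (+ 2 * s) * t₁       ≡⟨ rescale t₀ s t₁ ⟩
  t₀ + q * (s * s) * t₁
    ≡⟨ twist-step q (s * s) (suc n) j (+ U (suc n) j) (+ U (suc n) (suc j))
                  (λ n≤j → cong +_ (U-above (s≤s n≤j))) ⟩
  q ^ (suc n ∸ j) * (+ U (suc n) j + s * s * + U (suc n) (suc j))
    ≡⟨ cong (q ^ (suc n ∸ j) *_) (U-suc-suc n j) ⟨
  q ^ (suc n ∸ j) * + U (suc (suc n)) (suc j) ∎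
  where
  q = - + 4
  c = + (2 ℕ.+ double j)
  s = + suc j
  t₀ = q ^ (suc n ∸ j) * + U (suc n) j
  t₁ = q ^ (suc n ∸ suc j) * + U (suc n) (suc j)
  c≡2*suc-j : c ≡ + 2 * s
  c≡2*suc-j = trans (cong +_ (sym (2*≡double (suc j)))) (ℤP.pos-* 2 (suc j))
  rescale : ∀ x s y → x - + 2 * s * (+ 2 * s) * y ≡ x + - + 4 * (s * s) * y
  rescale = solve-∀

⊙S-below : ∀ c m → c ⊙ S m ≗[< m ] 0ₛ
⊙S-below c m n n<m = trans (cong (c *_) (S-below n<m)) (ℤP.*-zeroʳ c)

pos-suc-suc-! : ∀ x → + (suc (suc x) !) ≡ + suc x * + suc (suc x) * + (x !)
pos-suc-suc-! x = begin
  + (suc (suc x) ℕ.* (suc x ℕ.* x !))    ≡⟨ ℤP.pos-* (suc (suc x)) (suc x ℕ.* x !) ⟩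
  + suc (suc x) * + (suc x ℕ.* x !)      ≡⟨ cong (+ suc (suc x) *_) (ℤP.pos-* (suc x) (x !)) ⟩
  + suc (suc x) * (+ suc x * + (x !))    ≡⟨ rearrange (+ suc (suc x)) (+ suc x) (+ (x !)) ⟩
  + suc x * + suc (suc x) * + (x !)      ∎
  where
  rearrange : ∀ a b c → a * (b * c) ≡ b * a * c
  rearrange = solve-∀

-- Σ_{j<N} (k sin² z)^j, truncating 1/(1 - k sin² z).
sin²-geometric : ℕ → ℕ → Series
sin²-geometric k N = Σₛ N (λ j → (+ (k ℕ.^ j) * + (double j !)) ⊙ S (double j))

sin²-geometric-telescope : ∀ k N →
  (oneC ⊖ + k ⊙ (sinC ⋆ sinC)) ⋆ sin²-geometric k N
    ≗ oneC ⊖ (+ (k ℕ.^ N) * + (double N !)) ⊙ S (double N)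
sin²-geometric-telescope k N n =
  trans (⋆-telescope (+ k ⊙ (sinC ⋆ sinC)) g step N n)
        (cong (_- g N n) (ℤP.*-identityˡ (oneC n)))
  where
  g : ℕ → Series
  g j = (+ (k ℕ.^ j) * + (double j !)) ⊙ S (double j)
  collect : ∀ k p f a b y → k * (p * f * (a * b * y)) ≡ k * p * (a * b * f) * y
  collect = solve-∀
  step : ∀ j → + k ⊙ (sinC ⋆ sinC) ⋆ g j ≗ g (suc j)
  step j n = begin
    ((+ k ⊙ (sinC ⋆ sinC)) ⋆ g j) n
      ≡⟨ ⋆-scaleˡ (+ k) (sinC ⋆ sinC) (g j) n ⟩
    + k * ((sinC ⋆ sinC) ⋆ g j) n
      ≡⟨ cong (+ k *_) (⋆-scaleʳ (p * f) (sinC ⋆ sinC) (S (double j)) n) ⟩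
    + k * (p * f * ((sinC ⋆ sinC) ⋆ S (double j)) n)
      ≡⟨ cong (λ y → + k * (p * f * y)) (sin²⋆S (double j) n) ⟩
    + k * (p * f * (a * b * S (double (suc j)) n))
      ≡⟨ collect (+ k) p f a b (S (double (suc j)) n) ⟩
    + k * p * (a * b * f) * S (double (suc j)) n
      ≡⟨ cong₂ (λ p f → p * f * S (double (suc j)) n) (ℤP.pos-* k (k ℕ.^ j)) (pos-suc-suc-! (double j)) ⟨
    g (suc j) n ∎
    where
    p = + (k ℕ.^ j)
    f = + (double j !)
    a = + suc (double j)
    b = + suc (suc (double j))

tanSecApprox : ℕ → Series
tanSecApprox N = (oneC ⊕ sinC) ⋆ (cosC ⋆ sin²-geometric 1 N)

invCosMinusSinApprox : ℕ → Series
invCosMinusSinApprox N = (cosC ⊕ sinC) ⋆ sin²-geometric 2 N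

tanSecApprox⋆cos : ∀ N → tanSecApprox N ⋆ cosC ≗[< double N ] oneC ⊕ sinC
tanSecApprox⋆cos N n n<2N = begin
  (tanSecApprox N ⋆ cosC) n
    ≡⟨ ⋆-assoc (oneC ⊕ sinC) (cosC ⋆ G) cosC n ⟩
  ((oneC ⊕ sinC) ⋆ ((cosC ⋆ G) ⋆ cosC)) n
    ≡⟨ ⋆-congʳ (oneC ⊕ sinC) (λ k → trans (⋆-rotate cosC G cosC k) (⋆-congˡ G cos²′ k)) n ⟩
  ((oneC ⊕ sinC) ⋆ ((oneC ⊖ + 1 ⊙ (sinC ⋆ sinC)) ⋆ G)) n
    ≡⟨ ⋆-congʳ (oneC ⊕ sinC) (sin²-geometric-telescope 1 N) n ⟩
  ((oneC ⊕ sinC) ⋆ (oneC ⊖ c ⊙ S (double N))) n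
    ≡⟨ ⋆-distribˡ-⊖ (oneC ⊕ sinC) oneC (c ⊙ S (double N)) n ⟩
  ((oneC ⊕ sinC) ⋆ oneC) n - ((oneC ⊕ sinC) ⋆ (c ⊙ S (double N))) n
    ≡⟨ cong₂ _-_ (⋆-identityʳ (oneC ⊕ sinC) n)
                 (⋆-vanishes-below (oneC ⊕ sinC) (double N) (⊙S-below c (double N)) n n<2N) ⟩
  (oneC ⊕ sinC) n - + 0
    ≡⟨ ℤP.+-identityʳ _ ⟩
  (oneC ⊕ sinC) n ∎
  where
  G = sin²-geometric 1 N
  c = + (1 ℕ.^ N) * + (double N !)
  cos²′ : cosC ⋆ cosC ≗ oneC ⊖ + 1 ⊙ (sinC ⋆ sinC)
  cos²′ k = trans (cos² k) (cong (_-_ (oneC k)) (sym (ℤP.*-identityˡ ((sinC ⋆ sinC) k))))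

cos+sin⋆cos-sin : (cosC ⊕ sinC) ⋆ (cosC ⊖ sinC) ≗ oneC ⊖ + 2 ⊙ (sinC ⋆ sinC)
cos+sin⋆cos-sin n = begin
  ((cosC ⊕ sinC) ⋆ (cosC ⊖ sinC)) n
    ≡⟨ ⋆-distribʳ-⊕ cosC sinC (cosC ⊖ sinC) n ⟩
  (cosC ⋆ (cosC ⊖ sinC)) n + (sinC ⋆ (cosC ⊖ sinC)) n
    ≡⟨ cong₂ _+_ (⋆-distribˡ-⊖ cosC cosC sinC n) (⋆-distribˡ-⊖ sinC cosC sinC n) ⟩
  (cosC ⋆ cosC) n - (cosC ⋆ sinC) n + ((sinC ⋆ cosC) n - (sinC ⋆ sinC) n)
    ≡⟨ cong₂ (λ x y → x - (cosC ⋆ sinC) n + (y - (sinC ⋆ sinC) n)) (cos² n) (⋆-comm sinC cosC n) ⟩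
  oneC n - (sinC ⋆ sinC) n - (cosC ⋆ sinC) n + ((cosC ⋆ sinC) n - (sinC ⋆ sinC) n)
    ≡⟨ collect (oneC n) ((sinC ⋆ sinC) n) ((cosC ⋆ sinC) n) ⟩
  oneC n - + 2 * (sinC ⋆ sinC) n ∎
  where
  collect : ∀ o s x → o - s - x + (x - s) ≡ o - + 2 * s
  collect = solve-∀

invCosMinusSinApprox⋆cos-sin : ∀ N → invCosMinusSinApprox N ⋆ (cosC ⊖ sinC) ≗[< double N ] oneC
invCosMinusSinApprox⋆cos-sin N n n<2N = begin
  (invCosMinusSinApprox N ⋆ (cosC ⊖ sinC)) n
    ≡⟨ ⋆-rotate (cosC ⊕ sinC) G (cosC ⊖ sinC) n ⟩
  (((cosC ⊕ sinC) ⋆ (cosC ⊖ sinC)) ⋆ G) n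
    ≡⟨ ⋆-congˡ G cos+sin⋆cos-sin n ⟩
  ((oneC ⊖ + 2 ⊙ (sinC ⋆ sinC)) ⋆ G) n
    ≡⟨ sin²-geometric-telescope 2 N n ⟩
  oneC n - c * S (double N) n
    ≡⟨ cong (λ y → oneC n - y) (⊙S-below c (double N) n n<2N) ⟩
  oneC n - + 0
    ≡⟨ ℤP.+-identityʳ _ ⟩
  oneC n ∎
  where
  G = sin²-geometric 2 N
  c = + (2 ℕ.^ N) * + (double N !)

tanSecSummand : ℕ → ℕ → ℤ
tanSecSummand n j =
  + (double j !) * (S (suc (double j)) (suc n) + + suc (double j) * S (double (suc j)) (suc n))

tanSecApprox-coeff : ∀ N n → tanSecApprox N n ≡ Σ< N (tanSecSummand n)
tanSecApprox-coeff N n = begin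
  ((oneC ⊕ sinC) ⋆ (cosC ⋆ sin²-geometric 1 N)) n
    ≡⟨ ⋆-congʳ (oneC ⊕ sinC) (⋆-Σₛ-⊙ cosC N c (λ j → S (double j))) n ⟩
  ((oneC ⊕ sinC) ⋆ Σₛ N (λ j → c j ⊙ (cosC ⋆ S (double j)))) n
    ≡⟨ ⋆-Σₛ-⊙ (oneC ⊕ sinC) N c (λ j → cosC ⋆ S (double j)) n ⟩
  Σ< N (λ j → c j * ((oneC ⊕ sinC) ⋆ (cosC ⋆ S (double j))) n)
    ≡⟨ Σ<-cong N (λ j _ → cong₂ _*_ (c≡! j) (term (double j))) ⟩
  Σ< N (tanSecSummand n) ∎
  where
  c : ℕ → ℤ
  c j = + (1 ℕ.^ j) * + (double j !)
  c≡! : ∀ j → c j ≡ + (double j !)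
  c≡! j = trans (cong (λ p → + p * + (double j !)) (ℕP.^-zeroˡ j)) (ℤP.*-identityˡ (+ (double j !)))
  term : ∀ m → ((oneC ⊕ sinC) ⋆ (cosC ⋆ S m)) n ≡ S (suc m) (suc n) + + suc m * S (2 ℕ.+ m) (suc n)
  term m = begin
    ((oneC ⊕ sinC) ⋆ (cosC ⋆ S m)) n
      ≡⟨ ⋆-distribʳ-⊕ oneC sinC (cosC ⋆ S m) n ⟩
    (oneC ⋆ (cosC ⋆ S m)) n + (sinC ⋆ (cosC ⋆ S m)) n
      ≡⟨ cong₂ _+_ (⋆-identityˡ (cosC ⋆ S m) n) (⋆-swap sinC cosC (S m) n) ⟩
    (cosC ⋆ S m) n + (cosC ⋆ (sinC ⋆ S m)) n
      ≡⟨ cong (_+_ ((cosC ⋆ S m) n))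
              (trans (⋆-congʳ cosC (sin⋆S m) n) (⋆-scaleʳ (+ suc m) cosC (S (suc m)) n)) ⟩
    (cosC ⋆ S m) n + + suc m * (cosC ⋆ S (suc m)) n ∎

invCosMinusSinSummand : ℕ → ℕ → ℤ
invCosMinusSinSummand n j =
  + (2 ℕ.^ j) * + (double j !) * (S (suc (double j)) (suc n) + + suc (double j) * S (suc (double j)) n)

invCosMinusSinApprox-coeff : ∀ N n → invCosMinusSinApprox N n ≡ Σ< N (invCosMinusSinSummand n)
invCosMinusSinApprox-coeff N n = begin
  ((cosC ⊕ sinC) ⋆ sin²-geometric 2 N) n
    ≡⟨ ⋆-Σₛ-⊙ (cosC ⊕ sinC) N (λ j → + (2 ℕ.^ j) * + (double j !)) (λ j → S (double j)) n ⟩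
  Σ< N (λ j → + (2 ℕ.^ j) * + (double j !) * ((cosC ⊕ sinC) ⋆ S (double j)) n)
    ≡⟨ Σ<-cong N (λ j _ → cong (+ (2 ℕ.^ j) * + (double j !) *_) (term (double j))) ⟩
  Σ< N (invCosMinusSinSummand n) ∎
  where
  term : ∀ m → ((cosC ⊕ sinC) ⋆ S m) n ≡ S (suc m) (suc n) + + suc m * S (suc m) n
  term m = trans (⋆-distribʳ-⊕ cosC sinC (S m) n) (cong (_+_ ((cosC ⋆ S m) n)) (sin⋆S m n))

pos-suc-! : ∀ x → + suc x * + (x !) ≡ + (suc x !)
pos-suc-! x = sym (ℤP.pos-* (suc x) (x !))

tanSecApprox-even : ∀ n → tanSecApprox (suc n) (double n) ≡
                          ∑ 0 n (λ j → -1ℤ ^ (n ∸ j) * + ((2 ℕ.* j) !) * + V n j)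
tanSecApprox-even n = begin
  tanSecApprox (suc n) (double n)
    ≡⟨ tanSecApprox-coeff (suc n) (double n) ⟩
  Σ< (suc n) (tanSecSummand (double n))
    ≡⟨ Σ<-cong (suc n) (λ j _ → term j) ⟩
  Σ< (suc n) f
    ≡⟨ ∑≡Σ< 0 n f ⟨
  ∑ 0 n f ∎
  where
  f : ℕ → ℤ
  f j = -1ℤ ^ (n ∸ j) * + ((2 ℕ.* j) !) * + V n j
  collect : ∀ d p v a → d * (p * v + a * + 0) ≡ p * d * v
  collect = solve-∀
  term : ∀ j → tanSecSummand (double n) j ≡ f j
  term j = begin
    tanSecSummand (double n) j
      ≡⟨ cong₂ (λ x y → + (double j !) * (x + + suc (double j) * y))
               (S-odd-odd n j) (S-even-odd (suc j) n) ⟩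
    + (double j !) * (-1ℤ ^ (n ∸ j) * + V n j + + suc (double j) * + 0)
      ≡⟨ collect (+ (double j !)) (-1ℤ ^ (n ∸ j)) (+ V n j) (+ suc (double j)) ⟩
    -1ℤ ^ (n ∸ j) * + (double j !) * + V n j
      ≡⟨ cong (λ m → -1ℤ ^ (n ∸ j) * + (m !) * + V n j) (2*≡double j) ⟨
    f j ∎

tanSecApprox-odd : ∀ p → tanSecApprox (suc p) (suc (double p)) ≡
                         ∑ 1 (suc p) (λ j → (- + 4) ^ (suc p ∸ j) * + ((2 ℕ.* j ∸ 1) !) * + U (suc p) j)
tanSecApprox-odd p = begin
  tanSecApprox (suc p) (suc (double p))
    ≡⟨ tanSecApprox-coeff (suc p) (suc (double p)) ⟩
  Σ< (suc p) (tanSecSummand (suc (double p)))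
    ≡⟨ Σ<-cong (suc p) (λ j _ → term j) ⟩
  Σ< (suc p) (λ j → f (suc j))
    ≡⟨ ∑≡Σ< 1 (suc p) f ⟨
  ∑ 1 (suc p) f ∎
  where
  f : ℕ → ℤ
  f j = (- + 4) ^ (suc p ∸ j) * + ((2 ℕ.* j ∸ 1) !) * + U (suc p) j
  collect : ∀ d q u a → d * (+ 0 + a * (q * u)) ≡ q * (a * d) * u
  collect = solve-∀
  term : ∀ j → tanSecSummand (suc (double p)) j ≡ f (suc j)
  term j = begin
    tanSecSummand (suc (double p)) j
      ≡⟨ cong₂ (λ x y → + (double j !) * (x + + suc (double j) * y))
               (S-odd-even j (suc p)) (S-even-even p (suc j)) ⟩
    + (double j !) * (+ 0 + + suc (double j) * ((- + 4) ^ (p ∸ j) * + U (suc p) (suc j)))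
      ≡⟨ collect (+ (double j !)) ((- + 4) ^ (p ∸ j)) (+ U (suc p) (suc j)) (+ suc (double j)) ⟩
    (- + 4) ^ (p ∸ j) * (+ suc (double j) * + (double j !)) * + U (suc p) (suc j)
      ≡⟨ cong (λ x → (- + 4) ^ (p ∸ j) * x * + U (suc p) (suc j)) (pos-suc-! (double j)) ⟩
    (- + 4) ^ (p ∸ j) * + (suc (double j) !) * + U (suc p) (suc j)
      ≡⟨ cong (λ m → (- + 4) ^ (p ∸ j) * + ((m ∸ 1) !) * + U (suc p) (suc j)) (2*≡double (suc j)) ⟨
    f (suc j) ∎

invCosMinusSinApprox-even : ∀ n → invCosMinusSinApprox (suc n) (double n) ≡
  ∑ 0 n (λ j → -1ℤ ^ (n ∸ j) * + ((2 ℕ.* j) !) * + (2 ℕ.^ j) * + V n j)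
invCosMinusSinApprox-even n = begin
  invCosMinusSinApprox (suc n) (double n)
    ≡⟨ invCosMinusSinApprox-coeff (suc n) (double n) ⟩
  Σ< (suc n) (invCosMinusSinSummand (double n))
    ≡⟨ Σ<-cong (suc n) (λ j _ → term j) ⟩
  Σ< (suc n) f
    ≡⟨ ∑≡Σ< 0 n f ⟨
  ∑ 0 n f ∎
  where
  f : ℕ → ℤ
  f j = -1ℤ ^ (n ∸ j) * + ((2 ℕ.* j) !) * + (2 ℕ.^ j) * + V n j
  collect : ∀ t d p v a → t * d * (p * v + a * + 0) ≡ p * d * t * v
  collect = solve-∀
  term : ∀ j → invCosMinusSinSummand (double n) j ≡ f j
  term j = begin
    invCosMinusSinSummand (double n) j
      ≡⟨ cong₂ (λ x y → + (2 ℕ.^ j) * + (double j !) * (x + + suc (double j) * y))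
               (S-odd-odd n j) (S-odd-even j n) ⟩
    + (2 ℕ.^ j) * + (double j !) * (-1ℤ ^ (n ∸ j) * + V n j + + suc (double j) * + 0)
      ≡⟨ collect (+ (2 ℕ.^ j)) (+ (double j !)) (-1ℤ ^ (n ∸ j)) (+ V n j) (+ suc (double j)) ⟩
    -1ℤ ^ (n ∸ j) * + (double j !) * + (2 ℕ.^ j) * + V n j
      ≡⟨ cong (λ m → -1ℤ ^ (n ∸ j) * + (m !) * + (2 ℕ.^ j) * + V n j) (2*≡double j) ⟨
    f j ∎

invCosMinusSinApprox-odd : ∀ n → invCosMinusSinApprox (suc n) (suc (double n)) ≡
  ∑ 0 n (λ j → -1ℤ ^ (n ∸ j) * + ((2 ℕ.* j ℕ.+ 1) !) * + (2 ℕ.^ j) * + V n j)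
invCosMinusSinApprox-odd n = begin
  invCosMinusSinApprox (suc n) (suc (double n))
    ≡⟨ invCosMinusSinApprox-coeff (suc n) (suc (double n)) ⟩
  Σ< (suc n) (invCosMinusSinSummand (suc (double n)))
    ≡⟨ Σ<-cong (suc n) (λ j _ → term j) ⟩
  Σ< (suc n) f
    ≡⟨ ∑≡Σ< 0 n f ⟨
  ∑ 0 n f ∎
  where
  f : ℕ → ℤ
  f j = -1ℤ ^ (n ∸ j) * + ((2 ℕ.* j ℕ.+ 1) !) * + (2 ℕ.^ j) * + V n j
  collect : ∀ t d p v a → t * d * (+ 0 + a * (p * v)) ≡ p * (a * d) * t * v
  collect = solve-∀
  term : ∀ j → invCosMinusSinSummand (suc (double n)) j ≡ f j
  term j = begin
    invCosMinusSinSummand (suc (double n)) j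
      ≡⟨ cong₂ (λ x y → + (2 ℕ.^ j) * + (double j !) * (x + + suc (double j) * y))
               (S-odd-even j (suc n)) (S-odd-odd n j) ⟩
    + (2 ℕ.^ j) * + (double j !) * (+ 0 + + suc (double j) * (-1ℤ ^ (n ∸ j) * + V n j))
      ≡⟨ collect (+ (2 ℕ.^ j)) (+ (double j !)) (-1ℤ ^ (n ∸ j)) (+ V n j) (+ suc (double j)) ⟩
    -1ℤ ^ (n ∸ j) * (+ suc (double j) * + (double j !)) * + (2 ℕ.^ j) * + V n j
      ≡⟨ cong (λ x → -1ℤ ^ (n ∸ j) * x * + (2 ℕ.^ j) * + V n j) (pos-suc-! (double j)) ⟩
    -1ℤ ^ (n ∸ j) * + (suc (double j) !) * + (2 ℕ.^ j) * + V n j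
      ≡⟨ cong (λ m → -1ℤ ^ (n ∸ j) * + (m !) * + (2 ℕ.^ j) * + V n j) (2*+1≡suc-double j) ⟨
    f j ∎

tanSec-agrees : ∀ E → (∀ n → egfMul E cosC n ≡ oneC n + sinC n) →
                ∀ N → E ≗[< double N ] tanSecApprox N
tanSec-agrees E E⋆cos≡1+sin N = ⋆-cancelʳ-below cosC (double N) refl λ n n<2N → begin
  (E ⋆ cosC) n                ≡⟨ egfMul≗⋆ E cosC n ⟨
  egfMul E cosC n             ≡⟨ E⋆cos≡1+sin n ⟩
  oneC n + sinC n             ≡⟨ tanSecApprox⋆cos N n n<2N ⟨
  (tanSecApprox N ⋆ cosC) n   ∎

invCosMinusSin-agrees : ∀ s → (∀ n → egfMul s (λ k → cosC k - sinC k) n ≡ oneC n) →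
                        ∀ N → s ≗[< double N ] invCosMinusSinApprox N
invCosMinusSin-agrees s s⋆[cos-sin]≡1 N =
  ⋆-cancelʳ-below (cosC ⊖ sinC) (double N) refl λ n n<2N → begin
  (s ⋆ (cosC ⊖ sinC)) n                        ≡⟨ egfMul≗⋆ s (cosC ⊖ sinC) n ⟨
  egfMul s (cosC ⊖ sinC) n                     ≡⟨ s⋆[cos-sin]≡1 n ⟩
  oneC n                                       ≡⟨ invCosMinusSinApprox⋆cos-sin N n n<2N ⟨
  (invCosMinusSinApprox N ⋆ (cosC ⊖ sinC)) n   ∎

corollary7 : (E s : ℕ → ℤ)
    → (∀ n → egfMul E cosC n ≡ oneC n ℤ.+ sinC n)
    → (∀ n → egfMul s (λ k → cosC k ℤ.- sinC k) n ≡ oneC n)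
    → ∀ n → 1 ≤ n
    → (E (2 ℕ.* n ∸ 1) ≡ ∑ 1 n (λ j → ((- (+ 4)) ℤ.^ (n ∸ j)) ℤ.* (+ ((2 ℕ.* j ∸ 1) !)) ℤ.* (+ U n j)))
    × (E (2 ℕ.* n) ≡ ∑ 0 n (λ j → ((- (+ 1)) ℤ.^ (n ∸ j)) ℤ.* (+ ((2 ℕ.* j) !)) ℤ.* (+ V n j)))
    × (s (2 ℕ.* n) ≡ ∑ 0 n (λ j → ((- (+ 1)) ℤ.^ (n ∸ j)) ℤ.* (+ ((2 ℕ.* j) !)) ℤ.* (+ (2 ℕ.^ j)) ℤ.* (+ V n j)))
    × (s (2 ℕ.* n ℕ.+ 1) ≡ ∑ 0 n (λ j → ((- (+ 1)) ℤ.^ (n ∸ j)) ℤ.* (+ ((2 ℕ.* j ℕ.+ 1) !)) ℤ.* (+ (2 ℕ.^ j)) ℤ.* (+ V n j)))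
corollary7 E s hE hs n@(suc p) _ =
    trans (cong (λ m → E (m ∸ 1)) (2*≡double n))
          (trans (tanSec-agrees E hE n (suc (double p)) (ℕP.n<1+n _)) (tanSecApprox-odd p))
  , trans (cong E (2*≡double n))
          (trans (tanSec-agrees E hE (suc n) (double n) 2n<2n+2) (tanSecApprox-even n))
  , trans (cong s (2*≡double n))
          (trans (invCosMinusSin-agrees s hs (suc n) (double n) 2n<2n+2) (invCosMinusSinApprox-even n))
  , trans (cong s (2*+1≡suc-double n))
          (trans (invCosMinusSin-agrees s hs (suc n) (suc (double n)) (ℕP.n<1+n _))
                 (invCosMinusSinApprox-odd n))
  where
  2n<2n+2 : double n < double (suc n)
  2n<2n+2 = ℕP.m<n⇒m<1+n (ℕP.n<1+n (double n))
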